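{- Let $S$ be a near $e$ subsemigroup of a semitopological semigroup $(T,+)$. If $U\in\tau_e$, then $U\cap S\subseteq S$ is thick near $e$.
   Context: A semitopological semigroup $(T,+)$ is a semigroup (additive notation, not necessarily commutative) with a Hausdorff topology in which all left and right translations are continuous. $\tau_x$ is the set of neighborhoods of $x$ (sets containing $x$ in their interior). A subsemigroup $S$ of $T$ with $e$ an idempotent of $T$, $e\notin S$, is a near $e$ subsemigroup if $e\in cl_T(S)$. $A\subseteq S$ is thick near $e$ if there is $W\in\tau_e$ such that for every finite nonempty $F\subseteq W\cap S$ and every $V\in\tau_e$ there is $x\in V\cap S$ with $F+x\subseteq A$. -}

module Defs where

open import Level using (0ℓ)
open import Data.Empty using (⊥)
open import Data.Product using (Σ; ∃; _×_; _,_)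
open import Data.List.NonEmpty using (List⁺; toList)
open import Data.List.Relation.Unary.All using (All)
open import Relation.Unary using (Pred; _∈_; _∉_; _⊆_; _∩_)
open import Relation.Binary.PropositionalEquality using (_≡_; _≢_)
open import Algebra.Core using (Op₂)
open import Algebra.Structures using (IsSemigroup)

record IsHausdorffTopology (X : Set) (IsOpen : Pred X 0ℓ → Set) : Set₁ where
  field
    open-univ  : IsOpen (λ _ → X)
    open-∩     : ∀ {U V} → IsOpen U → IsOpen V → IsOpen (U ∩ V)
    open-⋃     : (I : Set) (U : I → Pred X 0ℓ) → (∀ i → IsOpen (U i)) →
                 IsOpen (λ x → Σ I λ i → x ∈ U i)
    hausdorff  : ∀ x y → x ≢ y →
                 ∃ λ U → ∃ λ V → IsOpen U × IsOpen V × x ∈ U × y ∈ V ×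
                   (∀ z → z ∈ U → z ∈ V → ⊥)

Continuous : {X : Set} → (Pred X 0ℓ → Set) → (X → X) → Set₁
Continuous {X} IsOpen f = ∀ (U : Pred X 0ℓ) → IsOpen U → IsOpen (λ x → f x ∈ U)

record SemitopologicalSemigroup : Set₁ where
  field
    Carrier      : Set
    _+_          : Op₂ Carrier
    isSemigroup  : IsSemigroup _≡_ _+_
    IsOpen       : Pred Carrier 0ℓ → Set
    isTopology   : IsHausdorffTopology Carrier IsOpen
    left-cont    : ∀ a → Continuous IsOpen (λ x → a + x)
    right-cont   : ∀ a → Continuous IsOpen (λ x → x + a)

module _ (T : SemitopologicalSemigroup) where
  open SemitopologicalSemigroup T

  -- τ_x : N is a neighbourhood of x iff x is in the interior of N.
  Nbhd : Carrier → Pred Carrier 0ℓ → Set₁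
  Nbhd x N = ∃ λ O → IsOpen O × x ∈ O × O ⊆ N

  InClosure : Pred Carrier 0ℓ → Carrier → Set₁
  InClosure S x = ∀ N → Nbhd x N → ∃ λ y → y ∈ N × y ∈ S

  IsSubsemigroup : Pred Carrier 0ℓ → Set
  IsSubsemigroup S = ∀ {x y} → x ∈ S → y ∈ S → (x + y) ∈ S

  Idempotent : Carrier → Set
  Idempotent e = e + e ≡ e

  NearSubsemigroup : Carrier → Pred Carrier 0ℓ → Set₁
  NearSubsemigroup e S =
    Idempotent e × IsSubsemigroup S × e ∉ S × InClosure S e

  ThickNear : Carrier → Pred Carrier 0ℓ → Pred Carrier 0ℓ → Set₁
  ThickNear e S A =
    ∃ λ W → Nbhd e W ×
      ((F : List⁺ Carrier) → All (λ f → f ∈ (W ∩ S)) (toList F) →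
       ∀ V → Nbhd e V →
       ∃ λ x → x ∈ (V ∩ S) × All (λ f → (f + x) ∈ A) (toList F))

module Submission where

open import Level using (0ℓ)
open import Data.Product using (∃; _×_; _,_; proj₂)
open import Data.List using (List; []; _∷_)
open import Data.List.NonEmpty using (toList)
open import Data.List.Relation.Unary.All as All using (All; []; _∷_)
open import Relation.Unary using (Pred; _∈_; _⊆_; _∩_)
open import Relation.Binary.PropositionalEquality using (subst; sym)
open import Function using (id)

open import Defs

-- For U ∋ e with open interior O, take W := {y | y + e ∈ O}, an open neighbourhood of e
-- since e + e = e. Given F ⊆ W ∩ S, the set {x | f + x ∈ O for all f ∈ F} is open
-- (left translations are continuous) and contains e, so it meets every neighbourhood of e
-- in a point x of S; then F + x ⊆ O ∩ S ⊆ U ∩ S because S is a subsemigroup.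

module _ {X : Set} where

  ⋂ : {I : Set} → List I → (I → Pred X 0ℓ) → Pred X 0ℓ
  ⋂ []       U = λ _ → X
  ⋂ (i ∷ is) U = U i ∩ ⋂ is U

  All⇒∈⋂ : {I : Set} (is : List I) {U : I → Pred X 0ℓ} {x : X} →
           All (λ i → x ∈ U i) is → x ∈ ⋂ is U
  All⇒∈⋂ []       {x = x} []         = x
  All⇒∈⋂ (i ∷ is)         (px ∷ pxs) = px , All⇒∈⋂ is pxs

  ∈⋂⇒All : {I : Set} (is : List I) {U : I → Pred X 0ℓ} {x : X} →
           x ∈ ⋂ is U → All (λ i → x ∈ U i) is
  ∈⋂⇒All []       _          = []
  ∈⋂⇒All (i ∷ is) (px , pxs) = px ∷ ∈⋂⇒All is pxs

  ⋂-open : {IsOpen : Pred X 0ℓ → Set} → IsHausdorffTopology X IsOpen →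
           {I : Set} (is : List I) (U : I → Pred X 0ℓ) →
           (∀ i → IsOpen (U i)) → IsOpen (⋂ is U)
  ⋂-open top []       U open-U = IsHausdorffTopology.open-univ top
  ⋂-open top (i ∷ is) U open-U =
    IsHausdorffTopology.open-∩ top (open-U i) (⋂-open top is U open-U)

module _ (T : SemitopologicalSemigroup) where
  open SemitopologicalSemigroup T
  open IsHausdorffTopology isTopology

  open⇒Nbhd : ∀ {O x} → IsOpen O → x ∈ O → Nbhd T x O
  open⇒Nbhd {O} open-O x∈O = O , open-O , x∈O , id

  Nbhd-∩-open : ∀ {N O x} → Nbhd T x N → IsOpen O → x ∈ O → Nbhd T x (N ∩ O)
  Nbhd-∩-open {O = O} (P , open-P , x∈P , P⊆N) open-O x∈O =
    P ∩ O , open-∩ open-P open-O , (x∈P , x∈O) , λ (p , o) → P⊆N p , o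

  left-translates-into : Pred Carrier 0ℓ → Carrier → Pred Carrier 0ℓ
  left-translates-into O f x = (f + x) ∈ O

  common-translate-into-open :
    ∀ {e S O} → InClosure T S e → IsOpen O → (F : List Carrier) →
    All (λ f → (f + e) ∈ O) F → ∀ V → Nbhd T e V →
    ∃ λ x → x ∈ (V ∩ S) × All (λ f → (f + x) ∈ O) F
  common-translate-into-open {O = O} e∈clS open-O F F+e⊆O V V∋e
    with x , (x∈V , x∈⋂) , x∈S ← e∈clS (V ∩ ⋂ F (left-translates-into O))
           (Nbhd-∩-open V∋e (⋂-open isTopology F _ (λ f → left-cont f O open-O))
                        (All⇒∈⋂ F F+e⊆O))
    = x , (x∈V , x∈S) , ∈⋂⇒All F x∈⋂

proposition2p19 : (T : SemitopologicalSemigroup) →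
    let open SemitopologicalSemigroup T in
    ∀ e S → NearSubsemigroup T e S → ∀ U → Nbhd T e U →
      ((U ∩ S) ⊆ S) × ThickNear T e S (U ∩ S)
proposition2p19 T e S (e+e≡e , S-closed , _ , e∈clS) U (O , open-O , e∈O , O⊆U) =
  proj₂ , W , open⇒Nbhd T (right-cont e O open-O) e∈W , thick
  where
  open SemitopologicalSemigroup T

  W : Pred Carrier 0ℓ
  W y = (y + e) ∈ O

  e∈W : e ∈ W
  e∈W = subst O (sym e+e≡e) e∈O

  thick : ∀ F → All (_∈ (W ∩ S)) (toList F) → ∀ V → Nbhd T e V →
          ∃ λ x → x ∈ (V ∩ S) × All (λ f → (f + x) ∈ (U ∩ S)) (toList F)
  thick F F⊆W∩S V V∋e
    with F⊆W , F⊆S ← All.unzip F⊆W∩S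
    with x , (x∈V , x∈S) , F+x⊆O ← common-translate-into-open T e∈clS open-O (toList F) F⊆W V V∋e
    = x , (x∈V , x∈S) , All.zipWith (λ (o , s) → O⊆U o , S-closed s x∈S) (F+x⊆O , F⊆S)
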